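{- Let $CC$ be a C-system, $g:Z\to Y$ and $f:Y\to X$ morphisms with $l(X)=m$. Then $s_i(f\circ g)=g^*(s_i(f))$ for $i=1,\dots,m$.
   Context: C-systems: a C0-system is a category $CC$ with a function $l:Ob(CC)\to\mathbb{N}$, an object $pt$, a function $ft:Ob\to Ob$, morphisms $p_X:X\to ft(X)$, and for $l(X)>0$, $f:Y\to ft(X)$ an object $f^*X$ and morphism $q(f,X):f^*X\to X$, such that: $pt$ is the only object of length $0$; $l(ftX)=l(X)-1$ for $l(X)>0$, $ft(pt)=pt$; $pt$ is final; $l(f^*X)>0$, $ft(f^*X)=Y$, $p_X\circ q(f,X)=f\circ p_{f^*X}$ and this square is a pullback; $(id_{ftX})^*X=X$, $q(id,X)=id_X$; $(f\circ g)^*X=g^*(f^*X)$, $q(f\circ g,X)=q(f,X)\circ q(g,f^*X)$. A C-system is a C0-system with, for every $f:Y\to X$ with $l(X)>0$, a morphism $s_f:Y\to(ft(f))^*X$, $ft(f):=p_X\circ f$, with $p_{(ftf)^*X}\circ s_f=id_Y$, $q(ftf,X)\circ s_f=f$, and $s_f=s_{q(g,U)\circ f}$ whenever $X=g^*U$ with $g:ft(X)\to ft(U)$. Let $\widetilde B_{k+1}=\{(V,t)\mid l(V)=k+1,\ t:ft(V)\to V,\ p_V\circ t=id\}$. For $(V,t)\in\widetilde B_{k+1}$ and $g:W\to ft(V)$, $g^*(V,t)=(g^*V,g^*(t))$, where $g^*(t):W\to g^*V$ is the unique morphism with $p_{g^*V}\circ g^*(t)=id_W$ and $q(g,V)\circ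 g^*(t)=t\circ g$. For a morphism $f:Y\to X$ with $l(Y)=n$, $l(X)=m$, the sequence $(s_1(f),\dots,s_m(f))$ of elements of $\widetilde B_{n+1}$ (each of the form $(V,t)$ with $ft(V)=Y$) is empty if $m=0$, and for $m\ge1$ equals $(s_1(ft(f)),\dots,s_{m-1}(ft(f)),((ft(f))^*X,s_f))$ with $ft(f)=p_X\circ f$. -}

module Defs where

open import Level using (Level; _⊔_) renaming (suc to lsuc)
open import Data.Nat using (ℕ; zero; suc; _∸_; _<_; s≤s; z≤n)
open import Data.Product using (_×_; _,_)
open import Data.Vec using (Vec; []; _∷ʳ_; map)
open import Relation.Binary.PropositionalEquality
  using (_≡_; refl; sym; trans; cong; subst)

-- A category is presented with a set of objects
-- Ob, a set of morphisms Mor, and dom/cod maps; composition  comp g f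
-- ( = g ∘ f ) is defined when dom g ≡ cod f (the proof is irrelevant, so
-- equations between morphisms are ordinary propositional equalities).
-- Partial operations (f^*X, q(f,X), s_f) likewise take irrelevant proofs
-- of their side conditions.

record C0System (o m : Level) : Set (lsuc (o ⊔ m)) where
  field
    Ob  : Set o
    Mor : Set m
    dom cod : Mor → Ob
    id      : Ob → Mor
    dom-id  : ∀ X → dom (id X) ≡ X
    cod-id  : ∀ X → cod (id X) ≡ X
    comp     : (g f : Mor) → .(dom g ≡ cod f) → Mor
    dom-comp : ∀ g f .(e : dom g ≡ cod f) → dom (comp g f e) ≡ dom f
    cod-comp : ∀ g f .(e : dom g ≡ cod f) → cod (comp g f e) ≡ cod g
    idl : ∀ f → comp (id (cod f)) f (dom-id (cod f)) ≡ f
    idr : ∀ f → comp f (id (dom f)) (sym (cod-id (dom f))) ≡ f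
    assoc : ∀ h g f .(e₁ : dom h ≡ cod g) .(e₂ : dom g ≡ cod f) →
      comp (comp h g e₁) f (trans (dom-comp h g e₁) e₂)
        ≡ comp h (comp g f e₂) (trans e₁ (sym (cod-comp g f e₂)))

    l  : Ob → ℕ
    pt : Ob
    ft : Ob → Ob
    p  : Ob → Mor
    dom-p : ∀ X → dom (p X) ≡ X
    cod-p : ∀ X → cod (p X) ≡ ft X

    pt-len    : l pt ≡ 0
    pt-unique : ∀ X → l X ≡ 0 → X ≡ pt
    l-ft      : ∀ X → 0 < l X → l (ft X) ≡ l X ∸ 1
    ft-pt     : ft pt ≡ pt

    term       : Ob → Mor
    dom-term   : ∀ X → dom (term X) ≡ X
    cod-term   : ∀ X → cod (term X) ≡ pt
    term-unique : ∀ f → cod f ≡ pt → f ≡ term (dom f)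

    star : (X : Ob) → .(0 < l X) → (f : Mor) → .(cod f ≡ ft X) → Ob
    q    : (X : Ob) → .(0 < l X) → (f : Mor) → .(cod f ≡ ft X) → Mor
    l-star  : ∀ X .(h : 0 < l X) f .(e : cod f ≡ ft X) → 0 < l (star X h f e)
    ft-star : ∀ X .(h : 0 < l X) f .(e : cod f ≡ ft X) → ft (star X h f e) ≡ dom f
    dom-q   : ∀ X .(h : 0 < l X) f .(e : cod f ≡ ft X) → dom (q X h f e) ≡ star X h f e
    cod-q   : ∀ X .(h : 0 < l X) f .(e : cod f ≡ ft X) → cod (q X h f e) ≡ X
    q-square : ∀ X .(h : 0 < l X) f .(e : cod f ≡ ft X) →
      comp (p X) (q X h f e) (trans (dom-p X) (sym (cod-q X h f e)))
        ≡ comp f (p (star X h f e))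
               (sym (trans (cod-p (star X h f e)) (ft-star X h f e)))
    pb-mor : ∀ X .(h : 0 < l X) f .(e : cod f ≡ ft X) (u v : Mor)
      .(eu : cod u ≡ X) .(ev : cod v ≡ dom f) →
      .(comp (p X) u (trans (dom-p X) (sym eu)) ≡ comp f v (sym ev)) → Mor
    pb-dom : ∀ X .(h : 0 < l X) f .(e : cod f ≡ ft X) u v .eu .ev .sq →
      dom (pb-mor X h f e u v eu ev sq) ≡ dom u
    pb-cod : ∀ X .(h : 0 < l X) f .(e : cod f ≡ ft X) u v .eu .ev .sq →
      cod (pb-mor X h f e u v eu ev sq) ≡ star X h f e
    pb-q : ∀ X .(h : 0 < l X) f .(e : cod f ≡ ft X) u v .eu .ev .sq →
      comp (q X h f e) (pb-mor X h f e u v eu ev sq)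
           (trans (dom-q X h f e) (sym (pb-cod X h f e u v eu ev sq))) ≡ u
    pb-p : ∀ X .(h : 0 < l X) f .(e : cod f ≡ ft X) u v .eu .ev .sq →
      comp (p (star X h f e)) (pb-mor X h f e u v eu ev sq)
           (trans (dom-p _) (sym (pb-cod X h f e u v eu ev sq))) ≡ v
    pb-unique : ∀ X .(h : 0 < l X) f .(e : cod f ≡ ft X) u v .eu .ev .sq
      (w : Mor) (ew : cod w ≡ star X h f e) →
      comp (q X h f e) w (trans (dom-q X h f e) (sym ew)) ≡ u →
      comp (p (star X h f e)) w (trans (dom-p _) (sym ew)) ≡ v →
      w ≡ pb-mor X h f e u v eu ev sq

    star-id : ∀ X .(h : 0 < l X) →
      star X h (id (ft X)) (cod-id (ft X)) ≡ X
    q-id : ∀ X .(h : 0 < l X) →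
      q X h (id (ft X)) (cod-id (ft X)) ≡ id X
    star-comp : ∀ X .(h : 0 < l X) f .(e : cod f ≡ ft X) g .(e' : dom f ≡ cod g) →
      star X h (comp f g e') (trans (cod-comp f g e') e)
        ≡ star (star X h f e) (l-star X h f e) g (trans (sym e') (sym (ft-star X h f e)))
    q-comp : ∀ X .(h : 0 < l X) f .(e : cod f ≡ ft X) g .(e' : dom f ≡ cod g) →
      q X h (comp f g e') (trans (cod-comp f g e') e)
        ≡ comp (q X h f e)
               (q (star X h f e) (l-star X h f e) g (trans (sym e') (sym (ft-star X h f e))))
               (trans (dom-q X h f e) (sym (cod-q _ _ g _)))

module C0Ops {o m : Level} (C : C0System o m) where
  open C0System C

  ftm : Mor → Mor
  ftm f = comp (p (cod f)) f (dom-p (cod f))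

  cod-ftm : ∀ f → cod (ftm f) ≡ ft (cod f)
  cod-ftm f = trans (cod-comp _ _ _) (cod-p (cod f))

  dom-ftm : ∀ f → dom (ftm f) ≡ dom f
  dom-ftm f = dom-comp _ _ _

module _ {o m : Level} (C : C0System o m) where
  open C0System C
  open C0Ops C

  record CStructure : Set (o ⊔ m) where
    field
      s : (f : Mor) → .(0 < l (cod f)) → Mor
      s-dom : ∀ f .(h : 0 < l (cod f)) → dom (s f h) ≡ dom f
      s-cod : ∀ f .(h : 0 < l (cod f)) →
        cod (s f h) ≡ star (cod f) h (ftm f) (cod-ftm f)
      s-p : ∀ f .(h : 0 < l (cod f)) →
        comp (p (star (cod f) h (ftm f) (cod-ftm f))) (s f h)
             (trans (dom-p _) (sym (s-cod f h))) ≡ id (dom f)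
      s-q : ∀ f .(h : 0 < l (cod f)) →
        comp (q (cod f) h (ftm f) (cod-ftm f)) (s f h)
             (trans (dom-q _ _ _ _) (sym (s-cod f h))) ≡ f
      s-nat : ∀ U .(hU : 0 < l U) g .(eg : cod g ≡ ft U) f
        .(ef : cod f ≡ star U hU g eg) →
        s f (subst (λ Z → 0 < l Z) (sym ef) (l-star U hU g eg))
          ≡ s (comp (q U hU g eg) f (trans (dom-q U hU g eg) (sym ef)))
              (subst (λ Z → 0 < l Z)
                 (sym (trans (cod-comp _ _ _) (cod-q U hU g eg))) hU)

record CSystem (o m : Level) : Set (lsuc (o ⊔ m)) where
  field
    C0 : C0System o m
    CS : CStructure C0
  open C0System C0 public
  open C0Ops C0 public
  open CStructure CS public

-- Elements of  B̃_{n+1}  lying over a fixed object Y (i.e. with ft V = Y,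
-- so l V = l Y + 1), the pullback action g^*, and the sequence s_i(f).

module _ {o m : Level} (C : CSystem o m) where
  open CSystem C

  private
    suc-pred : ∀ x → 0 < x → suc (x ∸ 1) ≡ x
    suc-pred (suc x) _ = refl

    ftlen : ∀ V → 0 < l V → l V ≡ suc (l (ft V))
    ftlen V h = trans (sym (suc-pred (l V) h)) (cong suc (sym (l-ft V h)))

  record B̃over (Y : Ob) : Set (o ⊔ m) where
    constructor mkB̃
    field
      V     : Ob
      t     : Mor
      ftV   : ft V ≡ Y
      lV    : l V ≡ suc (l Y)
      dom-t : dom t ≡ ft V
      cod-t : cod t ≡ V
      sect  : comp (p V) t (trans (dom-p V) (sym cod-t)) ≡ id (ft V)

  pair : ∀ {Y} → B̃over Y → Ob × Mor
  pair b = B̃over.V b , B̃over.t b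

  retarget : ∀ {Y Y'} → Y ≡ Y' → B̃over Y → B̃over Y'
  retarget refl b = b

  -- g^*(V , t) = (g^*V , g^*(t)),  g : W → Y = ft V ;
  -- g^*(t) is the unique morphism with p ∘ g^*(t) = id and q(g,V) ∘ g^*(t) = t ∘ g,
  -- obtained from the pullback property.
  gstar : ∀ {Y} (g : Mor) → cod g ≡ Y → B̃over Y → B̃over (dom g)
  gstar {Y} g eg (mkB̃ V t ftV lV dom-t cod-t sect) =
    mkB̃ V' t' (ft-star V hV g egV) lV' dom-t' (pb-cod V hV g egV u v eu ev sq) sect'
    where
      hV : 0 < l V
      hV = subst (0 <_) (sym lV) (s≤s z≤n)
      egV : cod g ≡ ft V
      egV = trans eg (sym ftV)
      V' = star V hV g egV
      u = comp t g (trans dom-t (sym egV))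
      v = id (dom g)
      eu : cod u ≡ V
      eu = trans (cod-comp _ _ _) cod-t
      ev : cod v ≡ dom g
      ev = cod-id (dom g)
      sq₀ : comp (p V) u (trans (dom-p V) (sym eu)) ≡ comp g v (sym ev)
      sq₀ =
        trans (sym (assoc (p V) t g (trans (dom-p V) (sym cod-t)) (trans dom-t (sym egV))))
          (trans (helper (comp (p V) t (trans (dom-p V) (sym cod-t))) _ sect)
            (trans (idl g) (sym (idr g))))
        where
          helper₀ : ∀ W → cod g ≡ W → .(ek : dom (id W) ≡ cod g) →
            comp (id W) g ek ≡ comp (id (cod g)) g (dom-id (cod g))
          helper₀ W refl ek = refl
          helper : ∀ k .(ek : dom k ≡ cod g) → k ≡ id (ft V) →
            comp k g ek ≡ comp (id (cod g)) g (dom-id (cod g))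
          helper k ek refl = helper₀ (ft V) egV ek
      sq = sq₀
      t' = pb-mor V hV g egV u v eu ev sq
      lV' : l V' ≡ suc (l (dom g))
      lV' = trans (ftlen V' (l-star V hV g egV)) (cong (λ Z → suc (l Z)) (ft-star V hV g egV))
      dom-t' : dom t' ≡ ft V'
      dom-t' = trans (pb-dom V hV g egV u v eu ev sq)
                 (trans (dom-comp _ _ _) (sym (ft-star V hV g egV)))
      sect' : comp (p V') t' _ ≡ id (ft V')
      sect' = trans (pb-p V hV g egV u v eu ev sq) (cong id (sym (ft-star V hV g egV)))

  sseq' : (f : Mor) (n : ℕ) → l (cod f) ≡ n → Vec (B̃over (dom f)) n
  sseq' f zero    e = []
  sseq' f (suc n) e =
    map (retarget (dom-ftm f))
        (sseq' (ftm f) n (trans (cong l (cod-ftm f)) (trans (l-ft (cod f) h) (cong (_∸ 1) e))))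
    ∷ʳ mkB̃ V (s f h) ftV lV (trans (s-dom f h) (sym ftV)) (s-cod f h)
           (trans (s-p f h) (cong id (sym ftV)))
    where
      h : 0 < l (cod f)
      h = subst (0 <_) (sym e) (s≤s z≤n)
      V = star (cod f) h (ftm f) (cod-ftm f)
      ftV : ft V ≡ dom f
      ftV = trans (ft-star _ _ _ _) (dom-ftm f)
      lV : l V ≡ suc (l (dom f))
      lV = trans (ftlen V (l-star _ _ _ _)) (cong (λ Z → suc (l Z)) ftV)

  sseq : (f : Mor) → Vec (B̃over (dom f)) (l (cod f))
  sseq f = sseq' f (l (cod f)) refl

module Submission where

-- Since ft(f ∘ g) = ft(f) ∘ g, the first m - 1 entries are
-- handled by the induction hypothesis applied to ft(f).  The whole content
-- lies in the last entry, which we treat first: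
--   * (ft(f ∘ g))^*X = g^*((ft f)^*X), by functoriality of pullback;
--   * p ∘ s_{f∘g} = id  and  q(g, (ft f)^*X) ∘ s_{f∘g} = s_f ∘ g, the latter
--     because both sides are maps into the pullback (ft f)^*X whose two
--     projections are f ∘ g and g, and these projections are jointly monic;
--   * hence s_{f∘g} is the morphism g^*(s_f) produced by the pullback.

open import Defs
open import Level using (Level)
open import Data.Nat using (zero; suc; _<_; _∸_; s≤s; z≤n; >-nonZero)
open import Data.Nat.Properties using (≡-irrelevant; suc-pred)
open import Data.Fin using (Fin; cast)
open import Data.Fin.Properties using (cast-is-id)
open import Data.Vec using (Vec; lookup; map; _∷ʳ_)
open import Data.Vec.Properties using (map-∷ʳ; map-∘; map-cong; lookup-map)
open import Data.Product using (_×_; _,_)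
open import Function using (_∘′_)
open import Relation.Binary.PropositionalEquality

map-snoc-≡ : ∀ {a b c} {A : Set a} {B : Set b} {R : Set c} {n}
  (F : A → R) (G : B → R) {xs : Vec A n} {ys : Vec B n} {x : A} {y : B} →
  map F xs ≡ map G ys → F x ≡ G y → map F (xs ∷ʳ x) ≡ map G (ys ∷ʳ y)
map-snoc-≡ F G {xs} {ys} {x} {y} eq-init eq-last =
  trans (map-∷ʳ F x xs) (trans (cong₂ _∷ʳ_ eq-init eq-last) (sym (map-∷ʳ G y ys)))

module C0Facts {o m : Level} (C : C0System o m) where
  open C0System C
  open C0Ops C

  comp-cong : ∀ {a a' b b'} → a ≡ a' → b ≡ b' →
    .(e : dom a ≡ cod b) .(e' : dom a' ≡ cod b') → comp a b e ≡ comp a' b' e'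
  comp-cong refl refl _ _ = refl

  star-cong : ∀ {X X' φ φ'} → X ≡ X' → φ ≡ φ' →
    .(h : 0 < l X) .(h' : 0 < l X') .(e : cod φ ≡ ft X) .(e' : cod φ' ≡ ft X') →
    star X h φ e ≡ star X' h' φ' e'
  star-cong refl refl _ _ _ _ = refl

  q-cong : ∀ {X X' φ φ'} → X ≡ X' → φ ≡ φ' →
    .(h : 0 < l X) .(h' : 0 < l X') .(e : cod φ ≡ ft X) .(e' : cod φ' ≡ ft X') →
    q X h φ e ≡ q X' h' φ' e'
  q-cong refl refl _ _ _ _ = refl

  id-comp : ∀ {Y} g → cod g ≡ Y → .(e : dom (id Y) ≡ cod g) → comp (id Y) g e ≡ g
  id-comp g refl _ = idl g

  comp-id : ∀ {Y} g → dom g ≡ Y → .(e : dom g ≡ cod (id Y)) → comp g (id Y) e ≡ g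
  comp-id g refl _ = idr g

  pb-jointly-monic : ∀ X .(h : 0 < l X) f .(e : cod f ≡ ft X) w w'
    (ew : cod w ≡ star X h f e) (ew' : cod w' ≡ star X h f e) →
    comp (q X h f e) w (trans (dom-q X h f e) (sym ew))
      ≡ comp (q X h f e) w' (trans (dom-q X h f e) (sym ew')) →
    comp (p (star X h f e)) w (trans (dom-p _) (sym ew))
      ≡ comp (p (star X h f e)) w' (trans (dom-p _) (sym ew')) →
    w ≡ w'
  pb-jointly-monic X h f e w w' ew ew' eq-q eq-p =
    trans (pb-unique X h f e u v eu ev square w ew refl refl)
          (sym (pb-unique X h f e u v eu ev square w' ew' (sym eq-q) (sym eq-p)))
    where
      V : Ob
      V = star X h f e
      u v : Mor
      u = comp (q X h f e) w (trans (dom-q X h f e) (sym ew))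
      v = comp (p V) w (trans (dom-p V) (sym ew))
      eu : cod u ≡ X
      eu = trans (cod-comp _ _ _) (cod-q X h f e)
      ev : cod v ≡ dom f
      ev = trans (cod-comp _ _ _) (trans (cod-p V) (ft-star X h f e))
      square : comp (p X) u (trans (dom-p X) (sym eu)) ≡ comp f v (sym ev)
      square =
        trans (sym (assoc (p X) (q X h f e) w _ _))
          (trans (comp-cong (q-square X h f e) refl _ _)
                 (assoc f (p V) w _ _))

  ftm-comp : ∀ f g .(e : dom f ≡ cod g) →
    ftm (comp f g e) ≡ comp (ftm f) g (trans (dom-ftm f) e)
  ftm-comp f g e =
    trans (comp-cong (cong p (cod-comp f g e)) refl _ _)
          (sym (assoc (p (cod f)) f g (dom-p (cod f)) e))

  star-ftm-comp : ∀ f g .(e : dom f ≡ cod g)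
    .(h : 0 < l (cod (comp f g e))) .(hf : 0 < l (cod f))
    .(eg : cod g ≡ ft (star (cod f) hf (ftm f) (cod-ftm f))) →
    star (cod (comp f g e)) h (ftm (comp f g e)) (cod-ftm (comp f g e))
      ≡ star (star (cod f) hf (ftm f) (cod-ftm f)) (l-star _ _ _ _) g eg
  star-ftm-comp f g e h hf eg =
    trans (star-cong (cod-comp f g e) (ftm-comp f g e) h hf _
                     (trans (cod-comp _ _ _) (cod-ftm f)))
          (star-comp (cod f) hf (ftm f) (cod-ftm f) g (trans (dom-ftm f) e))

module Sections {o m : Level} (C : CSystem o m) where
  open CSystem C
  open C0Facts C0

  -- For f : Y → X with l(X) > 0, the pair ((ft f)^*X, s_f) is an element of
  -- B̃ over Y; it is the last entry of the sequence of f.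
  section-B̃ : (f : Mor) .(h : 0 < l (cod f)) → B̃over C (dom f)
  section-B̃ f h =
    mkB̃ V (s f h) ftV lV (trans (s-dom f h) (sym ftV)) (s-cod f h)
        (trans (s-p f h) (cong id (sym ftV)))
    where
      V : Ob
      V = star (cod f) h (ftm f) (cod-ftm f)
      hV : 0 < l V
      hV = l-star (cod f) h (ftm f) (cod-ftm f)
      ftV : ft V ≡ dom f
      ftV = trans (ft-star _ _ _ _) (dom-ftm f)
      lV : l V ≡ suc (l (dom f))
      lV = trans (sym (suc-pred (l V) {{>-nonZero hV}}))
                 (cong suc (trans (sym (l-ft V hV)) (cong l ftV)))

  module LastEntry (f g : Mor) (e : dom f ≡ cod g)
                   .(hf : 0 < l (cod f)) .(hfg : 0 < l (cod (comp f g e))) where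
    fg : Mor
    fg = comp f g e

    V : Ob
    V = star (cod f) hf (ftm f) (cod-ftm f)

    hV : 0 < l V
    hV = l-star (cod f) hf (ftm f) (cod-ftm f)

    eg : cod g ≡ ft V
    eg = trans (sym (trans (dom-ftm f) e)) (sym (ft-star _ _ _ _))

    V' : Ob
    V' = star V hV g eg

    V-fg : star (cod fg) hfg (ftm fg) (cod-ftm fg) ≡ V'
    V-fg = star-ftm-comp f g e hfg hf eg

    cod-s-fg : cod (s fg hfg) ≡ V'
    cod-s-fg = trans (s-cod fg hfg) V-fg

    p-s-fg : comp (p V') (s fg hfg) (trans (dom-p _) (sym cod-s-fg)) ≡ id (dom g)
    p-s-fg =
      trans (comp-cong (cong p (sym V-fg)) refl _ _)
            (trans (s-p fg hfg) (cong id (dom-comp f g e)))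

    -- q(g,V) ∘ s_{f∘g} and s_f ∘ g are maps into V with the same projections:
    -- q(ft f, X) ∘ – is f ∘ g and p_V ∘ – is g for both.
    q-s-fg : comp (q V hV g eg) (s fg hfg) (trans (dom-q _ _ _ _) (sym cod-s-fg))
               ≡ comp (s f hf) g (trans (s-dom f hf) e)
    q-s-fg = pb-jointly-monic (cod f) hf (ftm f) (cod-ftm f) w₁ w₂ ew₁ ew₂
               (trans q-w₁ (sym q-w₂)) (trans p-w₁ (sym p-w₂))
      where
        qX w₁ w₂ : Mor
        qX = q (cod f) hf (ftm f) (cod-ftm f)
        w₁ = comp (q V hV g eg) (s fg hfg) (trans (dom-q _ _ _ _) (sym cod-s-fg))
        w₂ = comp (s f hf) g (trans (s-dom f hf) e)
        ew₁ : cod w₁ ≡ V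
        ew₁ = trans (cod-comp _ _ _) (cod-q V hV g eg)
        ew₂ : cod w₂ ≡ V
        ew₂ = trans (cod-comp _ _ _) (s-cod f hf)
        -- q(ft f, X) ∘ q(g, V) = q(ft f ∘ g, X) = q(ft(f∘g), X)
        q-w₁ : comp qX w₁ (trans (dom-q _ _ _ _) (sym ew₁)) ≡ fg
        q-w₁ =
          trans (sym (assoc qX (q V hV g eg) (s fg hfg) _ _))
            (trans (comp-cong (sym (q-comp (cod f) hf (ftm f) (cod-ftm f) g
                                            (trans (dom-ftm f) e))) refl _
                                 (trans (dom-q _ _ _ _)
                                        (trans (star-comp _ _ _ _ g _) (sym cod-s-fg))))
              (trans (comp-cong (q-cong (sym (cod-comp f g e)) (sym (ftm-comp f g e))
                                        hf hfg _ (cod-ftm fg)) refl _ _)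
                     (s-q fg hfg)))
        -- p_V ∘ q(g, V) = g ∘ p_{V'}, and p_{V'} ∘ s_{f∘g} = id
        p-w₁ : comp (p V) w₁ (trans (dom-p _) (sym ew₁)) ≡ g
        p-w₁ =
          trans (sym (assoc (p V) (q V hV g eg) (s fg hfg) _ _))
            (trans (comp-cong (q-square V hV g eg) refl _ _)
              (trans (assoc g (p V') (s fg hfg) _ _)
                (trans (comp-cong refl p-s-fg _ (sym (cod-id (dom g))))
                       (comp-id g refl _))))
        q-w₂ : comp qX w₂ (trans (dom-q _ _ _ _) (sym ew₂)) ≡ fg
        q-w₂ = trans (sym (assoc qX (s f hf) g _ _)) (comp-cong (s-q f hf) refl _ _)
        p-w₂ : comp (p V) w₂ (trans (dom-p _) (sym ew₂)) ≡ g
        p-w₂ =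
          trans (sym (assoc (p V) (s f hf) g _ _))
            (trans (comp-cong (s-p f hf) refl _ (trans (dom-id _) e))
                   (id-comp g (sym e) _))

    last-entry : (star (cod fg) hfg (ftm fg) (cod-ftm fg) , s fg hfg)
                   ≡ pair C (gstar C g (sym e) (section-B̃ f hf))
    last-entry =
      cong₂ _,_ V-fg
        (pb-unique V hV g eg (comp (s f hf) g _) (id (dom g)) _ _ _
                   (s fg hfg) cod-s-fg q-s-fg p-s-fg)

  pair-retarget : ∀ {Y Y'} (r : Y ≡ Y') (b : B̃over C Y) →
    pair C (retarget C r b) ≡ pair C b
  pair-retarget refl b = refl

  gstar-retarget : ∀ g {Y Y'} (r : Y ≡ Y') (eg : cod g ≡ Y') (eg' : cod g ≡ Y)
    (b : B̃over C Y) →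
    pair C (gstar C g eg (retarget C r b)) ≡ pair C (gstar C g eg' b)
  gstar-retarget g refl eg eg' b = refl

  sseq-pairs-cong : ∀ {φ ψ} n → φ ≡ ψ → (e : l (cod φ) ≡ n) (e' : l (cod ψ) ≡ n) →
    map (pair C) (sseq' C φ n e) ≡ map (pair C) (sseq' C ψ n e')
  sseq-pairs-cong n refl e e' rewrite ≡-irrelevant e e' = refl

  sseq-comp : ∀ n f g (e : dom f ≡ cod g)
    (efg : l (cod (comp f g e)) ≡ n) (ef : l (cod f) ≡ n) →
    map (pair C) (sseq' C (comp f g e) n efg)
      ≡ map (λ b → pair C (gstar C g (sym e) b)) (sseq' C f n ef)
  sseq-comp zero f g e efg ef = refl
  sseq-comp (suc n) f g e efg ef =
    map-snoc-≡ (pair C) gpair init (LastEntry.last-entry f g e hf hfg)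
    where
      gpair : B̃over C (dom f) → Ob × Mor
      gpair b = pair C (gstar C g (sym e) b)
      hf : 0 < l (cod f)
      hf = subst (0 <_) (sym ef) (s≤s z≤n)
      hfg : 0 < l (cod (comp f g e))
      hfg = subst (0 <_) (sym efg) (s≤s z≤n)
      e' : dom (ftm f) ≡ cod g
      e' = trans (dom-ftm f) e
      ef' : l (cod (ftm f)) ≡ n
      ef' = trans (cong l (cod-ftm f)) (trans (l-ft (cod f) hf) (cong (_∸ 1) ef))
      efg' : l (cod (ftm (comp f g e))) ≡ n
      efg' = trans (cong l (cod-ftm _)) (trans (l-ft _ hfg) (cong (_∸ 1) efg))
      efg'' : l (cod (comp (ftm f) g e')) ≡ n
      efg'' = trans (cong l (cod-comp _ _ e')) ef'
      init : map (pair C) (map (retarget C (dom-ftm (comp f g e)))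
                                (sseq' C (ftm (comp f g e)) n efg'))
           ≡ map gpair (map (retarget C (dom-ftm f)) (sseq' C (ftm f) n ef'))
      init =
        begin
          map (pair C) (map (retarget C _) (sseq' C (ftm (comp f g e)) n efg'))
        ≡⟨ sym (map-∘ (pair C) (retarget C _) _) ⟩
          map (pair C ∘′ retarget C _) (sseq' C (ftm (comp f g e)) n efg')
        ≡⟨ map-cong (pair-retarget _) _ ⟩
          map (pair C) (sseq' C (ftm (comp f g e)) n efg')
        ≡⟨ sseq-pairs-cong n (ftm-comp f g e) efg' efg'' ⟩
          map (pair C) (sseq' C (comp (ftm f) g e') n efg'')
        ≡⟨ sseq-comp n (ftm f) g e' efg'' ef' ⟩
          map (λ b → pair C (gstar C g (sym e') b)) (sseq' C (ftm f) n ef')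
        ≡⟨ map-cong (λ b → sym (gstar-retarget g (dom-ftm f) (sym e) (sym e') b)) _ ⟩
          map (gpair ∘′ retarget C (dom-ftm f)) (sseq' C (ftm f) n ef')
        ≡⟨ map-∘ gpair (retarget C _) _ ⟩
          map gpair (map (retarget C (dom-ftm f)) (sseq' C (ftm f) n ef'))
        ∎
        where open ≡-Reasoning

  lookup-cast : ∀ φ {n N} (c : n ≡ N) (e : l (cod φ) ≡ N) (e' : l (cod φ) ≡ n)
    (i : Fin n) →
    pair C (lookup (sseq' C φ N e) (cast c i)) ≡ pair C (lookup (sseq' C φ n e') i)
  lookup-cast φ refl e e' i rewrite ≡-irrelevant e e' | cast-is-id refl i = refl

lemma2p12 : ∀ {o m : Level} (C : CSystem o m) →
    let open CSystem C in
    (g f : Mor) (e : dom f ≡ cod g) (i : Fin (l (cod f))) →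
    pair C (lookup (sseq C (comp f g e)) (cast (sym (cong l (cod-comp f g e))) i))
      ≡ pair C (gstar C g (sym e) (lookup (sseq C f) i))
lemma2p12 C g f e i =
  begin
    pair C (lookup (sseq C (comp f g e)) (cast (sym l-fg) i))
  ≡⟨ lookup-cast (comp f g e) (sym l-fg) refl l-fg i ⟩
    pair C (lookup (sseq' C (comp f g e) _ l-fg) i)
  ≡⟨ sym (lookup-map i (pair C) (sseq' C (comp f g e) _ l-fg)) ⟩
    lookup (map (pair C) (sseq' C (comp f g e) _ l-fg)) i
  ≡⟨ cong (λ v → lookup v i) (sseq-comp (l (cod f)) f g e l-fg refl) ⟩
    lookup (map (λ b → pair C (gstar C g (sym e) b)) (sseq C f)) i
  ≡⟨ lookup-map i _ (sseq C f) ⟩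
    pair C (gstar C g (sym e) (lookup (sseq C f) i))
  ∎
  where
    open CSystem C
    open Sections C
    open ≡-Reasoning
    l-fg : l (cod (comp f g e)) ≡ l (cod f)
    l-fg = cong l (cod-comp f g e)
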